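{- Let $r\ge2$ and $m\ge3$ be integers. If $F$ is either $\left[\begin{smallmatrix}0\\1\\1\end{smallmatrix}\right]$ or $\left[\begin{smallmatrix}1&1\\0&1\\0&0\end{smallmatrix}\right]$, then \[\operatorname{forb}(m,r,F)=m(r-1)^{m-1}+2(r-1)^m-(r-2)^m-m(r-2)^{m-1}.\] If $F$ is either $\left[\begin{smallmatrix}1&0\\0&1\\0&0\end{smallmatrix}\right]$ or $\left[\begin{smallmatrix}1&0&1&0\\0&1&1&1\\0&0&0&1\end{smallmatrix}\right]$, then \[\operatorname{forb}(m,r,F)=2m(r-1)^{m-1}+(r-2)^m.\]
   Context: An $r$-matrix is a matrix with entries in $\{0,1,\dots,r-1\}$. A matrix is simple if it has no repeated columns. For matrices $F$ and $A$, $A$ avoids $F$ if no submatrix of $A$ is a row and column permutation of $F$. $\operatorname{forb}(m,r,F)$ is the maximum number of columns of a simple $m$-rowed $r$-matrix that avoids $F$. Powers of $0$ with positive exponent are $0$. -}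

module Defs where

open import Data.Nat using (ℕ; zero; suc; _≤_; _∸_; _^_)
open import Data.Fin using (Fin; toℕ)
open import Data.Vec using (Vec; []; _∷_; lookup)
open import Data.Product using (Σ; ∃; ∃-syntax; _×_; _,_)
open import Data.Integer as ℤ using (ℤ; +_)
open import Function.Definitions using (Injective)
open import Relation.Binary.PropositionalEquality using (_≡_)
open import Relation.Nullary using (¬_)

RMatrix : ℕ → ℕ → ℕ → Set
RMatrix r m n = Fin m → Fin n → Fin r

Simple : ∀ {r m n} → RMatrix r m n → Set
Simple {m = m} {n = n} A = ∀ (j j' : Fin n) → (∀ (i : Fin m) → A i j ≡ A i j') → j ≡ j'

Config : ℕ → ℕ → Set
Config k l = Fin k → Fin l → ℕ

Contains : ∀ {r m n k l} → RMatrix r m n → Config k l → Set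
Contains {m = m} {n = n} {k = k} {l = l} A F =
  Σ (Fin k → Fin m) λ ρ → Σ (Fin l → Fin n) λ γ →
    Injective _≡_ _≡_ ρ × Injective _≡_ _≡_ γ ×
    (∀ i j → toℕ (A (ρ i) (γ j)) ≡ F i j)

Avoids : ∀ {r m n k l} → RMatrix r m n → Config k l → Set
Avoids A F = ¬ Contains A F

IsForb : ∀ {k l} → ℕ → ℕ → Config k l → ℕ → Set
IsForb m r F N =
  (Σ (RMatrix r m N) λ A → Simple A × Avoids A F) ×
  (∀ (n : ℕ) (A : RMatrix r m n) → Simple A → Avoids A F → n ≤ N)

fromRows : ∀ {k l} → Vec (Vec ℕ l) k → Config k l
fromRows rows i j = lookup (lookup rows i) j

F₁ : Config 3 1
F₁ = fromRows ((0 ∷ []) ∷ (1 ∷ []) ∷ (1 ∷ []) ∷ [])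

F₂ : Config 3 2
F₂ = fromRows ((1 ∷ 1 ∷ []) ∷ (0 ∷ 1 ∷ []) ∷ (0 ∷ 0 ∷ []) ∷ [])

F₃ : Config 3 2
F₃ = fromRows ((1 ∷ 0 ∷ []) ∷ (0 ∷ 1 ∷ []) ∷ (0 ∷ 0 ∷ []) ∷ [])

F₄ : Config 3 4
F₄ = fromRows ((1 ∷ 0 ∷ 1 ∷ 0 ∷ []) ∷ (0 ∷ 1 ∷ 1 ∷ 1 ∷ []) ∷ (0 ∷ 0 ∷ 0 ∷ 1 ∷ []) ∷ [])

boundA : ℕ → ℕ → ℤ
boundA m r = (+ (m Data.Nat.* (r ∸ 1) ^ (m ∸ 1)) ℤ.+ + (2 Data.Nat.* (r ∸ 1) ^ m))
             ℤ.- + ((r ∸ 2) ^ m) ℤ.- + (m Data.Nat.* (r ∸ 2) ^ (m ∸ 1))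

boundB : ℕ → ℕ → ℤ
boundB m r = + (2 Data.Nat.* m Data.Nat.* (r ∸ 1) ^ (m ∸ 1) Data.Nat.+ (r ∸ 2) ^ m)

ForbEq : ∀ {k l} → ℕ → ℕ → Config k l → ℤ → Set
ForbEq m r F v = ∃[ N ] (IsForb m r F N × (+ N ≡ v))

module Submission where

-- Since F₁ occurs in F₂ and F₃ in F₄, it suffices to bound F₂-free (resp.
-- F₄-free) matrices from above and to construct F₁-free (resp. F₃-free)
-- matrices of the same size (lemma sandwich).
--
-- For simple binary matrices with k rows, the standard
-- decomposition on row 0 gives forb(k, F₂) ≤ g₂ k = k + 2 (k ≥ 2) and
-- forb(k, F₄) ≤ g₄ k = 2k (k ≥ 1): an F₄-free matrix has at most two "twin"
-- columns, an F₂-free one at most one unless it has at most four columns.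
-- An r-matrix is treated as a "mixed" matrix with k binary rows and m rows of
-- entries below s + 2; splitting the columns by their first non-binary entry
-- (a bit, or one of s larger values) yields the recursion
-- H(m+1, k) = H(m, k+1) + s·H(m, k), H(0, k) = g k, and forb(m, r, F) ≤ H(m, 0).
--
-- The same recursion builds H(m, k) distinct columns from binary
-- base families of size g k.  Every column has a local property (no pattern
-- [0;1;1], resp. "ranked": its 1s outrank any two of its 0s) preserved by the
-- recursion and excluding F₁, resp. F₃.

open import Defs
open import Data.Nat using (ℕ; zero; suc; _+_; _*_; _^_; _∸_; _≤_; _<_; z≤n; s≤s)
import Data.Nat as ℕ
open import Data.Nat.Properties
  using ( +-suc; +-assoc; +-comm; +-identityʳ; *-suc; *-assoc; +-mono-≤; +-monoʳ-<; +-cancelˡ-≡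
        ; ≤-trans; ≤-<-trans; <-trans; <-irrefl; <-asym; <⇒≱; ≮⇒≥; m≤m+n; m≤n+m; n<1+n
        ; m<1+n⇒m<n∨m≡n; n≤1⇒n≡0∨n≡1)
open import Data.Nat.Tactic.RingSolver using (solve-∀)
open import Data.Integer as ℤ using (ℤ; +_)
open import Data.Integer.Properties using (pos-+)
import Data.Integer.Tactic.RingSolver as ℤ-Ring
open import Data.Fin using (Fin; zero; suc; toℕ; fromℕ<; splitAt; join; remQuot; combine; _≟_)
open import Data.Fin.Properties
  using ( suc-injective; toℕ-injective; toℕ<n; toℕ-fromℕ<; join-splitAt; combine-remQuot
        ; injective⇒≤; ¬∀⟶∃¬; any?; all?)
open import Data.Product using (Σ; _×_; _,_; proj₁; proj₂; uncurry)
open import Data.Sum using (_⊎_; inj₁; inj₂; [_,_]′)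
open import Data.Sum.Properties using (inj₁-injective; inj₂-injective)
open import Data.Empty using (⊥; ⊥-elim)
open import Function using (_∘_; id)
import Function.Construct.Composition as Comp
open import Function.Definitions using (Injective)
open import Relation.Binary.PropositionalEquality
open import Relation.Nullary using (¬_; Dec; yes; no)
open import Relation.Nullary.Decidable using (_×-dec_)
open import Relation.Unary using (Decidable)
open ≡-Reasoning

Mat : Set → ℕ → Set
Mat R n = R → Fin n → ℕ

-- The entries of an r-matrix; Contains A F is literally Occurs (entries A) F.
entries : ∀ {r m n} → RMatrix r m n → Mat (Fin m) n
entries A i j = toℕ (A i j)

Inj : {A B : Set} → (A → B) → Set
Inj f = Injective _≡_ _≡_ f

∘-inj : {A B C : Set} {f : B → C} {g : A → B} → Inj f → Inj g → Inj (f ∘ g)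
∘-inj fi gi = Comp.injective _≡_ _≡_ _≡_ gi fi

Occurs : ∀ {R : Set} {n k l} → Mat R n → Config k l → Set
Occurs {R} {n} {k} {l} M F = Σ (Fin k → R) λ ρ → Σ (Fin l → Fin n) λ γ →
  Inj ρ × Inj γ × (∀ i j → M (ρ i) (γ j) ≡ F i j)

SimpleM : ∀ {R : Set} {n} → Mat R n → Set
SimpleM {R} {n} M = ∀ (j j' : Fin n) → (∀ i → M i j ≡ M i j') → j ≡ j'

occurs-sub : ∀ {R R' : Set} {n n' k l} (M : Mat R n) {F : Config k l}
  (φ : R' → R) (ψ : Fin n' → Fin n) → Inj φ → Inj ψ →
  Occurs (λ i j → M (φ i) (ψ j)) F → Occurs M F
occurs-sub M φ ψ φi ψi (ρ , γ , ρi , γi , e) = φ ∘ ρ , ψ ∘ γ , ∘-inj φi ρi , ∘-inj ψi γi , e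

Bit : ℕ → Set
Bit x = x ≡ 0 ⊎ x ≡ 1

Binary : ∀ {R : Set} {n} → Mat R n → Set
Binary M = ∀ i j → Bit (M i j)

bit<2 : ∀ {v} → Bit v → v < 2
bit<2 (inj₁ refl) = s≤s z≤n
bit<2 (inj₂ refl) = s≤s (s≤s z≤n)

bit≢2+ : ∀ {v} t → Bit v → ¬ v ≡ 2 + t
bit≢2+ t (inj₁ refl) ()
bit≢2+ t (inj₂ refl) ()

other-bit₁ : ∀ {a b} → Bit a → ¬ a ≡ b → b ≡ 0 → a ≡ 1
other-bit₁ (inj₁ refl) ne refl = ⊥-elim (ne refl)
other-bit₁ (inj₂ refl) ne _ = refl

other-bit₀ : ∀ {a b} → Bit a → ¬ a ≡ b → b ≡ 1 → a ≡ 0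
other-bit₀ (inj₁ refl) ne _ = refl
other-bit₀ (inj₂ refl) ne refl = ⊥-elim (ne refl)

record Split (c : ℕ) (P : Fin c → Set) : Set where
  field
    c₁ c₂ : ℕ
    e₁ : Fin c₁ → Fin c
    e₂ : Fin c₂ → Fin c
    i₁ : Inj e₁
    i₂ : Inj e₂
    p₁ : ∀ x → P (e₁ x)
    p₂ : ∀ x → ¬ P (e₂ x)
    total : c ≡ c₁ + c₂

cons : ∀ {a c} → (Fin a → Fin c) → Fin (suc a) → Fin (suc c)
cons e zero = zero
cons e (suc x) = suc (e x)

cons-inj : ∀ {a c} {e : Fin a → Fin c} → Inj e → Inj (cons e)
cons-inj ei {zero} {zero} eq = refl
cons-inj ei {suc x} {suc y} eq = cong suc (ei (suc-injective eq))

suc-inj : ∀ {a c} {e : Fin a → Fin c} → Inj e → Inj (suc ∘ e)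
suc-inj ei eq = ei (suc-injective eq)

split : ∀ c {P : Fin c → Set} → Decidable P → Split c P
split zero P? = record
  { c₁ = 0 ; c₂ = 0 ; e₁ = λ () ; e₂ = λ () ; i₁ = λ { {()} } ; i₂ = λ { {()} }
  ; p₁ = λ () ; p₂ = λ () ; total = refl }
split (suc c) {P} P? with split c (P? ∘ suc) | P? zero
... | S | yes p = record
  { c₁ = suc c₁ ; c₂ = c₂ ; e₁ = cons e₁ ; e₂ = suc ∘ e₂ ; i₁ = cons-inj i₁ ; i₂ = suc-inj i₂
  ; p₁ = λ { zero → p ; (suc x) → p₁ x } ; p₂ = p₂ ; total = cong suc total }
  where open Split S
... | S | no np = record
  { c₁ = c₁ ; c₂ = suc c₂ ; e₁ = suc ∘ e₁ ; e₂ = cons e₂ ; i₁ = suc-inj i₁ ; i₂ = cons-inj i₂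
  ; p₁ = p₁ ; p₂ = λ { zero → np ; (suc x) → p₂ x }
  ; total = trans (cong suc total) (sym (+-suc c₁ c₂)) }
  where open Split S

remQuot-inj : ∀ {s} b → Inj (remQuot {s} b)
remQuot-inj {s} b {z} {z'} eq =
  trans (sym (combine-remQuot {s} b z)) (trans (cong (uncurry combine) eq) (combine-remQuot {s} b z'))

splitAt-inj : ∀ a {b} → Inj (splitAt a {b})
splitAt-inj a {b} {x} {y} eq =
  trans (sym (join-splitAt a b x)) (trans (cong (join a b) eq) (join-splitAt a b y))

tail-simple : ∀ {k n c} (M : Mat (Fin (suc k)) n) → SimpleM M → (e : Fin c → Fin n) → Inj e →
  (∀ x x' → M zero (e x) ≡ M zero (e x')) → SimpleM (λ i x → M (suc i) (e x))
tail-simple M s e ei h0 x x' h = ei (s _ _ λ { zero → h0 x x' ; (suc i) → h i })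

no-rows : ∀ {R : Set} {n} (M : Mat R n) → (R → ⊥) → SimpleM M → n ≤ 1
no-rows M e s = injective⇒≤ {f = λ _ → zero} λ {j} {j'} _ → s j j' (⊥-elim ∘ e)

pow2 : ∀ k {n} (M : Mat (Fin k) n) → Binary M → SimpleM M → n ≤ 2 ^ k
pow2 zero M b s = no-rows M (λ ()) s
pow2 (suc k) {n} M b s = subst (_≤ 2 ^ suc k) (sym total)
    (+-mono-≤ (pow2 k _ (λ i x → b (suc i) (e₁ x)) (tail-simple M s e₁ i₁ λ x x' → trans (p₁ x) (sym (p₁ x'))))
              (subst (c₂ ≤_) (sym (+-identityʳ (2 ^ k)))
                (pow2 k _ (λ i x → b (suc i) (e₂ x)) (tail-simple M s e₂ i₂ λ x x' → trans (one x) (sym (one x'))))))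
  where
  open Split (split n (λ j → M zero j ℕ.≟ 0))
  one : ∀ x → M zero (e₂ x) ≡ 1
  one x = other-bit₁ (b zero (e₂ x)) (p₂ x) refl

record Twins {k n} (M : Mat (Fin (suc k)) n) (c : ℕ) : Set where
  field
    twin : Fin c → Fin n
    twin-inj : Inj twin
    twin-0 : ∀ x → M zero (twin x) ≡ 0
    partner : ∀ x → Σ (Fin n) λ j → M zero j ≡ 1 × (∀ i → M (suc i) j ≡ M (suc i) (twin x))

record Decomposition {k n} (M : Mat (Fin (suc k)) n) : Set where
  field
    c a : ℕ
    twins : Twins M c
    rest : Fin a → Fin n
    rest-inj : Inj rest
    rest-simple : SimpleM (λ i x → M (suc i) (rest x))
    total : n ≡ c + a

decompose : ∀ {k n} (M : Mat (Fin (suc k)) n) → Binary M → SimpleM M → Decomposition M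
decompose {k} {n} M b s = record
  { c = T.c₁ ; a = T.c₂ + Z.c₂
  ; twins = record { twin = Z.e₁ ∘ T.e₁ ; twin-inj = ∘-inj Z.i₁ T.i₁ ; twin-0 = Z.p₁ ∘ T.e₁ ; partner = T.p₁ }
  ; rest = rest ∘ splitAt T.c₂ ; rest-inj = splitAt-inj T.c₂ ∘ rest-inj
  ; rest-simple = λ x x' h → splitAt-inj T.c₂ (rest-simple _ _ h)
  ; total = trans Z.total (trans (cong (_+ Z.c₂) T.total) (+-assoc T.c₁ T.c₂ Z.c₂)) }
  where
  module Z = Split (split n (λ j → M zero j ℕ.≟ 0))
  HasPartner : Fin Z.c₁ → Set
  HasPartner x = Σ (Fin n) λ j → M zero j ≡ 1 × (∀ i → M (suc i) j ≡ M (suc i) (Z.e₁ x))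
  hasPartner? : ∀ x → Dec (HasPartner x)
  hasPartner? x = any? λ j → (M zero j ℕ.≟ 1) ×-dec all? λ i → M (suc i) j ℕ.≟ M (suc i) (Z.e₁ x)
  module T = Split (split Z.c₁ hasPartner?)
  one : ∀ z → M zero (Z.e₂ z) ≡ 1
  one z = other-bit₁ (b zero (Z.e₂ z)) (Z.p₂ z) refl
  rest : Fin T.c₂ ⊎ Fin Z.c₂ → Fin n
  rest (inj₁ y) = Z.e₁ (T.e₂ y)
  rest (inj₂ z) = Z.e₂ z
  rest-inj : Inj rest
  rest-inj {inj₁ y} {inj₁ y'} eq = cong inj₁ (T.i₂ (Z.i₁ eq))
  rest-inj {inj₂ z} {inj₂ z'} eq = cong inj₂ (Z.i₂ eq)
  rest-inj {inj₁ y} {inj₂ z} eq = ⊥-elim (Z.p₂ z (subst (λ j → M zero j ≡ 0) eq (Z.p₁ (T.e₂ y))))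
  rest-inj {inj₂ z} {inj₁ y} eq = ⊥-elim (Z.p₂ z (subst (λ j → M zero j ≡ 0) (sym eq) (Z.p₁ (T.e₂ y))))
  -- A 0-column and a 1-column with equal restrictions would make the 0-column a twin.
  rest-simple : ∀ u v → (∀ i → M (suc i) (rest u) ≡ M (suc i) (rest v)) → u ≡ v
  rest-simple (inj₁ y) (inj₁ y') h =
    cong inj₁ (tail-simple M s (Z.e₁ ∘ T.e₂) (∘-inj Z.i₁ T.i₂) (λ _ _ → trans (Z.p₁ _) (sym (Z.p₁ _))) y y' h)
  rest-simple (inj₂ z) (inj₂ z') h =
    cong inj₂ (tail-simple M s Z.e₂ Z.i₂ (λ x x' → trans (one x) (sym (one x'))) z z' h)
  rest-simple (inj₁ y) (inj₂ z) h = ⊥-elim (T.p₂ y (Z.e₂ z , one z , λ i → sym (h i)))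
  rest-simple (inj₂ z) (inj₁ y) h = ⊥-elim (T.p₂ y (Z.e₂ z , one z , h))

pattern 0F = zero
pattern 1F = suc zero
pattern 2F = suc (suc zero)
pattern 3F = suc (suc (suc zero))

rows-inj : ∀ {R : Set} {n k l} (M : Mat R n) {F : Config k l} (ρ : Fin k → R) (γ : Fin l → Fin n) →
  (∀ i j → M (ρ i) (γ j) ≡ F i j) → (∀ i i' → (∀ j → F i j ≡ F i' j) → i ≡ i') → Inj ρ
rows-inj M ρ γ e d {i} {i'} eq =
  d i i' λ j → trans (sym (e i j)) (trans (cong (λ z → M z (γ j)) eq) (e i' j))

cols-inj : ∀ {R : Set} {n k l} (M : Mat R n) {F : Config k l} (ρ : Fin k → R) (γ : Fin l → Fin n) →
  (∀ i j → M (ρ i) (γ j) ≡ F i j) → (∀ j j' → (∀ i → F i j ≡ F i j') → j ≡ j') → Inj γ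
cols-inj M ρ γ e d {j} {j'} eq =
  d j j' λ i → trans (sym (e i j)) (trans (cong (M (ρ i)) eq) (e i j'))

F₂-rows : ∀ i i' → (∀ j → F₂ i j ≡ F₂ i' j) → i ≡ i'
F₂-rows 0F 0F h = refl
F₂-rows 1F 1F h = refl
F₂-rows 2F 2F h = refl
F₂-rows 0F 1F h with () ← h 0F
F₂-rows 0F 2F h with () ← h 0F
F₂-rows 1F 0F h with () ← h 0F
F₂-rows 1F 2F h with () ← h 1F
F₂-rows 2F 0F h with () ← h 0F
F₂-rows 2F 1F h with () ← h 1F

F₂-cols : ∀ j j' → (∀ i → F₂ i j ≡ F₂ i j') → j ≡ j'
F₂-cols 0F 0F h = refl
F₂-cols 1F 1F h = refl
F₂-cols 0F 1F h with () ← h 1F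
F₂-cols 1F 0F h with () ← h 1F

F₄-rows : ∀ i i' → (∀ j → F₄ i j ≡ F₄ i' j) → i ≡ i'
F₄-rows 0F 0F h = refl
F₄-rows 1F 1F h = refl
F₄-rows 2F 2F h = refl
F₄-rows 0F 1F h with () ← h 0F
F₄-rows 0F 2F h with () ← h 0F
F₄-rows 1F 0F h with () ← h 0F
F₄-rows 1F 2F h with () ← h 1F
F₄-rows 2F 0F h with () ← h 0F
F₄-rows 2F 1F h with () ← h 1F

F₄-cols : ∀ j j' → (∀ i → F₄ i j ≡ F₄ i j') → j ≡ j'
F₄-cols 0F 0F h = refl
F₄-cols 1F 1F h = refl
F₄-cols 2F 2F h = refl
F₄-cols 3F 3F h = refl
F₄-cols 0F 1F h with () ← h 0F
F₄-cols 0F 2F h with () ← h 1F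
F₄-cols 0F 3F h with () ← h 0F
F₄-cols 1F 0F h with () ← h 0F
F₄-cols 1F 2F h with () ← h 0F
F₄-cols 1F 3F h with () ← h 2F
F₄-cols 2F 0F h with () ← h 1F
F₄-cols 2F 1F h with () ← h 0F
F₄-cols 2F 3F h with () ← h 0F
F₄-cols 3F 0F h with () ← h 0F
F₄-cols 3F 1F h with () ← h 2F
F₄-cols 3F 2F h with () ← h 0F

occurs-F₂ : ∀ {R : Set} {n} (M : Mat R n) (a b c : R) (x y : Fin n) →
  M a x ≡ 1 → M b x ≡ 0 → M c x ≡ 0 → M a y ≡ 1 → M b y ≡ 1 → M c y ≡ 0 → Occurs M F₂
occurs-F₂ {R} {n} M a b c x y ax bx cx ay by cy =
  ρ , γ , rows-inj M ρ γ E F₂-rows , cols-inj M ρ γ E F₂-cols , E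
  where
  ρ : Fin 3 → R
  ρ 0F = a
  ρ 1F = b
  ρ 2F = c
  γ : Fin 2 → Fin n
  γ 0F = x
  γ 1F = y
  E : ∀ i j → M (ρ i) (γ j) ≡ F₂ i j
  E 0F 0F = ax
  E 1F 0F = bx
  E 2F 0F = cx
  E 0F 1F = ay
  E 1F 1F = by
  E 2F 1F = cy

occurs-F₄ : ∀ {R : Set} {n} (M : Mat R n) (a b c : R) (w x y z : Fin n) →
  M a w ≡ 1 → M b w ≡ 0 → M c w ≡ 0 → M a x ≡ 0 → M b x ≡ 1 → M c x ≡ 0 →
  M a y ≡ 1 → M b y ≡ 1 → M c y ≡ 0 → M a z ≡ 0 → M b z ≡ 1 → M c z ≡ 1 → Occurs M F₄
occurs-F₄ {R} {n} M a b c w x y z aw bw cw ax bx cx ay by cy az bz cz =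
  ρ , γ , rows-inj M ρ γ E F₄-rows , cols-inj M ρ γ E F₄-cols , E
  where
  ρ : Fin 3 → R
  ρ 0F = a
  ρ 1F = b
  ρ 2F = c
  γ : Fin 4 → Fin n
  γ 0F = w
  γ 1F = x
  γ 2F = y
  γ 3F = z
  E : ∀ i j → M (ρ i) (γ j) ≡ F₄ i j
  E 0F 0F = aw
  E 1F 0F = bw
  E 2F 0F = cw
  E 0F 1F = ax
  E 1F 1F = bx
  E 2F 1F = cx
  E 0F 2F = ay
  E 1F 2F = by
  E 2F 2F = cy
  E 0F 3F = az
  E 1F 3F = bz
  E 2F 3F = cz

differ-at : ∀ {k} (u v : Fin k → ℕ) → ¬ (∀ i → u i ≡ v i) → Σ (Fin k) λ i → ¬ u i ≡ v i
differ-at {k} u v ne = ¬∀⟶∃¬ k (λ i → u i ≡ v i) (λ i → u i ℕ.≟ v i) ne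

third-bit : ∀ {a b c} → Bit a → Bit b → Bit c → ¬ a ≡ b → c ≡ a ⊎ c ≡ b
third-bit (inj₁ refl) (inj₁ refl) _ ne = ⊥-elim (ne refl)
third-bit (inj₂ refl) (inj₂ refl) _ ne = ⊥-elim (ne refl)
third-bit (inj₁ refl) (inj₂ refl) (inj₁ refl) ne = inj₁ refl
third-bit (inj₁ refl) (inj₂ refl) (inj₂ refl) ne = inj₂ refl
third-bit (inj₂ refl) (inj₁ refl) (inj₁ refl) ne = inj₂ refl
third-bit (inj₂ refl) (inj₁ refl) (inj₂ refl) ne = inj₁ refl

record Path {X : Set} {k} (R : X → Fin k → ℕ) : Set where
  field
    u v w : X
    i j : Fin k
    ui : ¬ R u i ≡ R v i
    wi : R w i ≡ R v i
    uj : R u j ≡ R v j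
    wj : ¬ R w j ≡ R v j

path : ∀ {X : Set} {k} (R : X → Fin k → ℕ) → (∀ x i → Bit (R x i)) → (u v w : X) →
  ¬ (∀ i → R u i ≡ R v i) → ¬ (∀ i → R v i ≡ R w i) → ¬ (∀ i → R u i ≡ R w i) → Path R
path R b u v w uv vw uw with differ-at (R u) (R v) uv
... | i , ne with third-bit (b u i) (b v i) (b w i) ne
...   | inj₂ wi=vi with differ-at (R v) (R w) vw
...     | j , ne' with third-bit (b v j) (b w j) (b u j) ne'
...       | inj₁ uj=vj = record { u = u ; v = v ; w = w ; i = i ; j = j
                                ; ui = ne ; wi = wi=vi ; uj = uj=vj ; wj = ne' ∘ sym }
...       | inj₂ uj=wj = record { u = u ; v = w ; w = v ; i = i ; j = j
                                ; ui = λ e → ne (trans e wi=vi) ; wi = sym wi=vi ; uj = uj=wj ; wj = ne' }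
path R b u v w uv vw uw | i , ne | inj₁ wi=ui with differ-at (R u) (R w) uw
...     | j , ne' with third-bit (b u j) (b w j) (b v j) ne'
...       | inj₁ vj=uj = record { u = v ; v = u ; w = w ; i = i ; j = j
                                ; ui = ne ∘ sym ; wi = wi=ui ; uj = vj=uj ; wj = ne' ∘ sym }
...       | inj₂ vj=wj = record { u = v ; v = w ; w = u ; i = i ; j = j
                                ; ui = λ e → ne (sym (trans e wi=ui)) ; wi = sym wi=ui ; uj = vj=wj ; wj = ne' }

record Doubled {k n} (M : Mat (Fin (suc k)) n) (i j : Fin k) (p q : ℕ) : Set where
  field
    c₀ c₁ : Fin n
    z₀ : M zero c₀ ≡ 0
    z₁ : M zero c₁ ≡ 1
    i₀ : M (suc i) c₀ ≡ p
    j₀ : M (suc j) c₀ ≡ q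
    i₁ : M (suc i) c₁ ≡ p
    j₁ : M (suc j) c₁ ≡ q

-- Three doubled patterns on a pair of rows yield F₄, in three ways
-- (with row 0 playing the role of the first, second or third row of F₄).
module _ {k n} (M : Mat (Fin (suc k)) n) (i j : Fin k) where
  open Doubled

  F₄-from-00-10-11 : Doubled M i j 0 0 → Doubled M i j 1 0 → Doubled M i j 1 1 → Occurs M F₄
  F₄-from-00-10-11 U V W = occurs-F₄ M zero (suc i) (suc j) (c₁ U) (c₀ V) (c₁ V) (c₀ W)
    (z₁ U) (i₁ U) (j₁ U) (z₀ V) (i₀ V) (j₀ V) (z₁ V) (i₁ V) (j₁ V) (z₀ W) (i₀ W) (j₀ W)

  F₄-from-10-00-01 : Doubled M i j 1 0 → Doubled M i j 0 0 → Doubled M i j 0 1 → Occurs M F₄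
  F₄-from-10-00-01 U V W = occurs-F₄ M (suc i) zero (suc j) (c₀ U) (c₁ V) (c₁ U) (c₁ W)
    (i₀ U) (z₀ U) (j₀ U) (i₁ V) (z₁ V) (j₁ V) (i₁ U) (z₁ U) (j₁ U) (i₁ W) (z₁ W) (j₁ W)

  F₄-from-10-01-11 : Doubled M i j 1 0 → Doubled M i j 0 1 → Doubled M i j 1 1 → Occurs M F₄
  F₄-from-10-01-11 U V W = occurs-F₄ M (suc i) (suc j) zero (c₀ U) (c₀ V) (c₀ W) (c₁ V)
    (i₀ U) (j₀ U) (z₀ U) (i₀ V) (j₀ V) (z₀ V) (i₀ W) (j₀ W) (z₀ W) (i₁ V) (j₁ V) (z₁ V)

module TwinFacts {k n} (M : Mat (Fin (suc k)) n) (b : Binary M) (s : SimpleM M) {c} (T : Twins M c) where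
  open Twins T

  below : Fin c → Fin k → ℕ
  below x i = M (suc i) (twin x)

  below-bit : ∀ x i → Bit (below x i)
  below-bit x i = b (suc i) (twin x)

  below-distinct : ∀ x x' → ¬ x ≡ x' → ¬ (∀ i → below x i ≡ below x' i)
  below-distinct x x' ne h = ne (tail-simple M s twin twin-inj (λ x x' → trans (twin-0 x) (sym (twin-0 x'))) x x' h)

  partner-below : ∀ x i → M (suc i) (proj₁ (partner x)) ≡ below x i
  partner-below x = proj₂ (proj₂ (partner x))

  doubled : ∀ x i j → Doubled M i j (below x i) (below x j)
  doubled x i j = record
    { c₀ = twin x ; c₁ = proj₁ (partner x) ; z₀ = twin-0 x ; z₁ = proj₁ (proj₂ (partner x))
    ; i₀ = refl ; j₀ = refl ; i₁ = partner-below x i ; j₁ = partner-below x j }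

  doubled-at : ∀ x i j {p q} → below x i ≡ p → below x j ≡ q → Doubled M i j p q
  doubled-at x i j ep eq = subst₂ (Doubled M i j) ep eq (doubled x i j)

  F₄-from-path : Path below → Occurs M F₄
  F₄-from-path P = by-middle (below-bit v i) (below-bit v j)
    where
    open Path P
    by-middle : Bit (below v i) → Bit (below v j) → Occurs M F₄
    by-middle (inj₁ vi0) (inj₁ vj0) = F₄-from-10-00-01 M i j
      (doubled-at u i j (other-bit₁ (below-bit u i) ui vi0) (trans uj vj0))
      (doubled-at v i j vi0 vj0)
      (doubled-at w i j (trans wi vi0) (other-bit₁ (below-bit w j) wj vj0))
    by-middle (inj₁ vi0) (inj₂ vj1) = F₄-from-00-10-11 M j i
      (doubled-at w j i (other-bit₀ (below-bit w j) wj vj1) (trans wi vi0))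
      (doubled-at v j i vj1 vi0)
      (doubled-at u j i (trans uj vj1) (other-bit₁ (below-bit u i) ui vi0))
    by-middle (inj₂ vi1) (inj₁ vj0) = F₄-from-00-10-11 M i j
      (doubled-at u i j (other-bit₀ (below-bit u i) ui vi1) (trans uj vj0))
      (doubled-at v i j vi1 vj0)
      (doubled-at w i j (trans wi vi1) (other-bit₁ (below-bit w j) wj vj0))
    by-middle (inj₂ vi1) (inj₂ vj1) = F₄-from-10-01-11 M i j
      (doubled-at w i j (trans wi vi1) (other-bit₀ (below-bit w j) wj vj1))
      (doubled-at u i j (other-bit₀ (below-bit u i) ui vi1) (trans uj vj1))
      (doubled-at v i j vi1 vj1)

twins-F₄ : ∀ {k n} (M : Mat (Fin (suc k)) n) → Binary M → SimpleM M → ¬ Occurs M F₄ →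
  ∀ c → Twins M c → c ≤ 2
twins-F₄ M b s av 0 T = z≤n
twins-F₄ M b s av 1 T = s≤s z≤n
twins-F₄ M b s av 2 T = s≤s (s≤s z≤n)
twins-F₄ M b s av (suc (suc (suc c))) T = ⊥-elim (av (F₄-from-path
    (path below below-bit 0F 1F 2F (below-distinct _ _ λ ()) (below-distinct _ _ λ ()) (below-distinct _ _ λ ()))))
  where open TwinFacts M b s T

module F₂-free {k n} (M : Mat (Fin (suc (suc k))) n) (b : Binary M) (s : SimpleM M) (av : ¬ Occurs M F₂) where

  ConstantBelow : Fin n → Set
  ConstantBelow y = ∀ i → M (suc i) y ≡ M 1F y

  one-and-zero : ∀ y → ¬ ConstantBelow y →
    Σ (Fin (suc k)) λ p → Σ (Fin (suc k)) λ q → M (suc p) y ≡ 1 × M (suc q) y ≡ 0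
  one-and-zero y nc with differ-at (λ i → M (suc i) y) (λ _ → M 1F y) nc | b 1F y
  ... | i , d | inj₁ y0 = i , zero , other-bit₁ (b (suc i) y) d y0 , y0
  ... | i , d | inj₂ y1 = zero , i , y1 , other-bit₀ (b (suc i) y) d y1

  -- Given Z = (1,0,…,0) and O = (0,1,…,1), every column is constant below row 0:
  -- otherwise Z (or O) and that column form F₂.
  all-constant : (Z O : Fin n) → M zero Z ≡ 1 → (∀ i → M (suc i) Z ≡ 0) →
    M zero O ≡ 0 → (∀ i → M (suc i) O ≡ 1) → ∀ y → ConstantBelow y
  all-constant Z O Z0 Zr O0 Or y with all? (λ i → M (suc i) y ℕ.≟ M 1F y)
  ... | yes h = h
  ... | no nh with one-and-zero y nh | b zero y
  ...   | p , q , yp , yq | inj₂ y1 = ⊥-elim (av (occurs-F₂ M zero (suc p) (suc q) Z y Z0 (Zr p) (Zr q) y1 yp yq))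
  ...   | p , q , yp , yq | inj₁ y0 = ⊥-elim (av (occurs-F₂ M (suc p) (suc q) zero y O yp yq y0 (Or p) (Or q) O0))

  -- If every column is constant below row 0, rows 0 and 1 determine the column.
  two-rows : (∀ y → ConstantBelow y) → n ≤ 4
  two-rows cb = pow2 2 M₂ (λ { 0F → b zero ; 1F → b 1F }) simple
    where
    M₂ : Mat (Fin 2) n
    M₂ 0F = M zero
    M₂ 1F = M 1F
    simple : SimpleM M₂
    simple j j' h = s j j' λ { zero → h 0F ; (suc i) → trans (cb j i) (trans (h 1F) (sym (cb j' i))) }

  module _ {c} (T : Twins M c) where
    open Twins T
    open TwinFacts M b s T

    -- A twin with a 1 at p and a 0 at q below row 0 gives F₂ together with its partner.
    twin-constant : ∀ x → ConstantBelow (twin x)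
    twin-constant x with all? (λ i → M (suc i) (twin x) ℕ.≟ M 1F (twin x))
    ... | yes h = h
    ... | no nh with one-and-zero (twin x) nh
    ...   | p , q , xp , xq = ⊥-elim (av (occurs-F₂ M (suc p) zero (suc q) (twin x) (proj₁ (partner x))
              xp (twin-0 x) xq (trans (partner-below x p) xp) (proj₁ (proj₂ (partner x))) (trans (partner-below x q) xq)))

    -- A twin with 0s below and a twin with 1s below supply the columns Z and O.
    from-01 : ∀ x x' → below x 0F ≡ 0 → below x' 0F ≡ 1 → n ≤ 4
    from-01 x x' x0 x'1 = two-rows (all-constant (proj₁ (partner x)) (twin x')
      (proj₁ (proj₂ (partner x))) (λ i → trans (partner-below x i) (trans (twin-constant x i) x0))
      (twin-0 x') (λ i → trans (twin-constant x' i) x'1))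

    -- Two twins constant below row 0 with the same value there would coincide.
    same-bit : ∀ {x x' v} → ¬ x ≡ x' → below x 0F ≡ v → below x' 0F ≡ v → ⊥
    same-bit {x} {x'} ne e e' = below-distinct x x' ne
      λ i → trans (twin-constant x i) (trans (trans e (sym e')) (sym (twin-constant x' i)))

twins-F₂ : ∀ {k n} (M : Mat (Fin (suc (suc k))) n) → Binary M → SimpleM M → ¬ Occurs M F₂ →
  ∀ c → Twins M c → c ≤ 1 ⊎ n ≤ 4
twins-F₂ M b s av 0 T = inj₁ z≤n
twins-F₂ M b s av 1 T = inj₁ (s≤s z≤n)
twins-F₂ M b s av (suc (suc c)) T with below-bit 0F 0F | below-bit 1F 0F
  where open TwinFacts M b s T
... | inj₁ e | inj₂ e' = inj₂ (F₂-free.from-01 M b s av T 0F 1F e e')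
... | inj₂ e | inj₁ e' = inj₂ (F₂-free.from-01 M b s av T 1F 0F e' e)
... | inj₁ e | inj₁ e' = ⊥-elim (F₂-free.same-bit M b s av T (λ ()) e e')
... | inj₂ e | inj₂ e' = ⊥-elim (F₂-free.same-bit M b s av T (λ ()) e e')

BinaryBound : ∀ {p l} → Config p l → ℕ → ℕ → Set
BinaryBound F k g = ∀ {n} (M : Mat (Fin k) n) → Binary M → SimpleM M → ¬ Occurs M F → n ≤ g

-- Induction step through the standard decomposition: t twins plus the rest,
-- which is F-free on one row fewer.
decomposition-bound : ∀ {k n p l t g} {F : Config p l} (M : Mat (Fin (suc k)) n)
  (b : Binary M) (s : SimpleM M) → ¬ Occurs M F → BinaryBound F k g →
  Decomposition.c (decompose M b s) ≤ t → n ≤ t + g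
decomposition-bound M b s av bound c≤t = subst (_≤ _) (sym total)
    (+-mono-≤ c≤t (bound _ (λ i x → b (suc i) (rest x)) rest-simple (av ∘ occurs-sub M suc rest suc-injective rest-inj)))
  where open Decomposition (decompose M b s)

g₂ : ℕ → ℕ
g₂ 0 = 1
g₂ 1 = 2
g₂ (suc (suc k)) = 4 + k

F₂-binary-bound : ∀ k → BinaryBound F₂ k (g₂ k)
F₂-binary-bound 0 M b s av = no-rows M (λ ()) s
F₂-binary-bound 1 M b s av = pow2 1 M b s
F₂-binary-bound 2 M b s av = pow2 2 M b s
F₂-binary-bound (suc (suc (suc k))) M b s av =
  [ decomposition-bound M b s av (F₂-binary-bound (suc (suc k)))
  , (λ n≤4 → ≤-trans n≤4 (m≤m+n 4 (suc k))) ]′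
  (twins-F₂ M b s av _ (Decomposition.twins (decompose M b s)))

g₄ : ℕ → ℕ
g₄ 0 = 1
g₄ (suc k) = 2 * suc k

F₄-binary-bound : ∀ k → BinaryBound F₄ k (g₄ k)
F₄-binary-bound 0 M b s av = no-rows M (λ ()) s
F₄-binary-bound 1 M b s av = pow2 1 M b s
F₄-binary-bound (suc (suc k)) {n} M b s av = subst (n ≤_) (sym (*-suc 2 (suc k)))
  (decomposition-bound M b s av (F₄-binary-bound (suc k)) (twins-F₄ M b s av _ (Decomposition.twins (decompose M b s))))

-- Mixed matrices have rows Fin k ⊎ Fin m: k binary rows (inj₁) and m rows
-- with entries below 2 + s (inj₂).
Rows : ℕ → ℕ → Set
Rows k m = Fin k ⊎ Fin m

promote : ∀ {k m} → Rows (suc k) m → Rows k (suc m)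
promote (inj₁ zero) = inj₂ zero
promote (inj₁ (suc i)) = inj₁ i
promote (inj₂ i) = inj₂ (suc i)

demote : ∀ {k m} → Rows k (suc m) → Rows (suc k) m
demote (inj₁ i) = inj₁ (suc i)
demote (inj₂ zero) = inj₁ zero
demote (inj₂ (suc i)) = inj₂ i

demote-promote : ∀ {k m} (r : Rows (suc k) m) → demote (promote r) ≡ r
demote-promote (inj₁ zero) = refl
demote-promote (inj₁ (suc i)) = refl
demote-promote (inj₂ i) = refl

promote-demote : ∀ {k m} (r : Rows k (suc m)) → promote (demote r) ≡ r
promote-demote (inj₁ i) = refl
promote-demote (inj₂ zero) = refl
promote-demote (inj₂ (suc i)) = refl

promote-inj : ∀ {k m} → Inj (promote {k} {m})
promote-inj {x = x} {y} e = trans (sym (demote-promote x)) (trans (cong demote e) (demote-promote y))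

demote-inj : ∀ {k m} → Inj (demote {k} {m})
demote-inj {x = x} {y} e = trans (sym (promote-demote x)) (trans (cong promote e) (promote-demote y))

skip : ∀ {k m} → Rows k m → Rows k (suc m)
skip (inj₁ i) = inj₁ i
skip (inj₂ i) = inj₂ (suc i)

skip-inj : ∀ {k m} → Inj (skip {k} {m})
skip-inj {x = inj₁ i} {inj₁ i'} e = cong inj₁ (inj₁-injective e)
skip-inj {x = inj₂ i} {inj₂ i'} e = cong inj₂ (suc-injective (inj₂-injective e))

-- The recursive bound: columns of a simple F-free mixed matrix with k binary
-- rows and m rows of entries below 2 + s, given the binary bound g.
H : ℕ → (ℕ → ℕ) → ℕ → ℕ → ℕ
H s g zero k = g k
H s g (suc m) k = H s g m (suc k) + s * H s g m k

MixedBound : ∀ {p l} → Config p l → ℕ → ℕ → ℕ → ℕ → Set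
MixedBound F s k m N = ∀ {n} (M : Mat (Rows k m) n) → (∀ i j → Bit (M (inj₁ i) j)) →
  (∀ i j → M (inj₂ i) j < 2 + s) → SimpleM M → ¬ Occurs M F → n ≤ N

-- Columns whose first non-binary entry lies in [2, 2 + t) split into t classes
-- by that value; within a class the entry is constant, so deleting it leaves a
-- simple F-free matrix bounded by N.
large-entries : ∀ {p l s k m N} {F : Config p l} → MixedBound F s k m N →
  ∀ {n} (M : Mat (Rows k (suc m)) n) → (∀ i j → Bit (M (inj₁ i) j)) →
  (∀ i j → M (inj₂ i) j < 2 + s) → SimpleM M → ¬ Occurs M F →
  ∀ t c (e : Fin c → Fin n) → Inj e →
  (∀ x → 2 ≤ M (inj₂ zero) (e x) × M (inj₂ zero) (e x) < 2 + t) → c ≤ t * N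
large-entries bound M b bd sm av zero zero e ei h = z≤n
large-entries bound M b bd sm av zero (suc c) e ei h = ⊥-elim (<⇒≱ (proj₂ (h zero)) (proj₁ (h zero)))
large-entries {N = N} bound M b bd sm av (suc t) c e ei h = subst (_≤ suc t * N) (sym total)
    (+-mono-≤ (bound _ (λ i → b i ∘ e ∘ e₁) (λ i → bd (suc i) ∘ e ∘ e₁) class-simple
                 (av ∘ occurs-sub M skip (e ∘ e₁) skip-inj (∘-inj ei i₁)))
              (large-entries bound M b bd sm av t c₂ (e ∘ e₂) (∘-inj ei i₂) λ x → proj₁ (h (e₂ x)) , below x))
  where
  open Split (split c (λ x → M (inj₂ zero) (e x) ℕ.≟ 2 + t))
  class-simple : SimpleM (λ r x → M (skip r) (e (e₁ x)))
  class-simple x x' h' = i₁ (ei (sm _ _ λ { (inj₁ i) → h' (inj₁ i)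
                                          ; (inj₂ zero) → trans (p₁ x) (sym (p₁ x'))
                                          ; (inj₂ (suc i)) → h' (inj₂ i) }))
  below : ∀ x → M (inj₂ zero) (e (e₂ x)) < 2 + t
  below x with m<1+n⇒m<n∨m≡n (proj₂ (h (e₂ x)))
  ... | inj₁ lt = lt
  ... | inj₂ eq = ⊥-elim (p₂ x eq)

module Upper (s : ℕ) (g : ℕ → ℕ) {p l} (F : Config p l) (binary : ∀ k → BinaryBound F k (g k)) where

  -- Split the columns by whether the first non-binary entry is a bit: those
  -- columns form a matrix with one more binary row, the others are handled by
  -- large-entries.
  mixed-bound : ∀ m k → MixedBound F s k m (H s g m k)
  mixed-bound zero k M b bd sm av = binary k (λ i → M (inj₁ i)) b
    (λ j j' h → sm j j' λ { (inj₁ i) → h i ; (inj₂ ()) })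
    (av ∘ occurs-sub M inj₁ id inj₁-injective id)
  mixed-bound (suc m) k {n} M b bd sm av = subst (_≤ H s g (suc m) k) (sym total)
      (+-mono-≤ (mixed-bound m (suc k) (λ r → M (promote r) ∘ e₁) promoted-bits (λ i → bd (suc i) ∘ e₁) promoted-simple
                   (av ∘ occurs-sub M promote e₁ promote-inj i₁))
                (large-entries (mixed-bound m k) M b bd sm av s c₂ e₂ i₂ λ x → ≮⇒≥ (p₂ x) , bd zero (e₂ x)))
    where
    open Split (split n (λ j → M (inj₂ zero) j ℕ.<? 2))
    promoted-bits : ∀ i x → Bit (M (promote (inj₁ i)) (e₁ x))
    promoted-bits zero x = n≤1⇒n≡0∨n≡1 (ℕ.s≤s⁻¹ (p₁ x))
    promoted-bits (suc i) x = b i (e₁ x)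
    promoted-simple : SimpleM (λ r x → M (promote r) (e₁ x))
    promoted-simple x x' h = i₁ (sm _ _ λ r →
      subst (λ r' → M r' (e₁ x) ≡ M r' (e₁ x')) (promote-demote r) (h (demote r)))

  -- An r-matrix with r = 2 + s is a mixed matrix without binary rows.
  r-matrix-bound : ∀ m {n} (A : RMatrix (2 + s) m n) → Simple A → Avoids A F → n ≤ H s g m 0
  r-matrix-bound m A sA av = mixed-bound m 0 (λ r → entries A (only r)) (λ ())
      (λ i j → toℕ<n (A i j)) (λ j j' h → sA j j' (λ i → toℕ-injective (h (inj₂ i))))
      (av ∘ occurs-sub (entries A) only id only-inj id)
    where
    only : Rows 0 m → Fin m
    only = [ (λ ()) , id ]′
    only-inj : Inj only
    only-inj {inj₂ i} {inj₂ i'} e = cong inj₂ e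

insert : ∀ {k m} → ℕ → (Rows k m → ℕ) → Rows k (suc m) → ℕ
insert v y (inj₁ i) = y (inj₁ i)
insert v y (inj₂ zero) = v
insert v y (inj₂ (suc j)) = y (inj₂ j)

-- The lower bound mirrors the recursion of H: from families for (m, k + 1) and
-- (m, k), build one for (m + 1, k) by reading the first binary row as a
-- non-binary one, and by inserting each value 2, …, s + 1 above the (m, k) family.
-- Good is a property of columns preserved by both operations.
module Families (s : ℕ) (g : ℕ → ℕ) (Good : ∀ {k m} → (Rows k m → ℕ) → Set)
  (good-demote : ∀ {k m} (y : Rows (suc k) m → ℕ) → Good y → Good (λ r → y (demote r)))
  (good-insert : ∀ {k m} (y : Rows k m → ℕ) v → 2 ≤ v → Good y → Good (insert v y)) where

  record Family (k m N : ℕ) : Set where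
    field
      col : Fin N → Rows k m → ℕ
      distinct : ∀ x y → (∀ r → col x r ≡ col y r) → x ≡ y
      bits : ∀ x i → Bit (col x (inj₁ i))
      small : ∀ x i → col x (inj₂ i) < 2 + s
      good : ∀ x → Good (col x)

  family : (∀ k → Family k 0 (g k)) → ∀ m k → Family k m (H s g m k)
  family base zero k = base k
  family base (suc m) k = record
    { col = λ x → col (splitAt a x)
    ; distinct = λ x y h → splitAt-inj a (distinct _ _ h)
    ; bits = λ x → bits (splitAt a x)
    ; small = λ x → small (splitAt a x)
    ; good = λ x → good (splitAt a x) }
    where
    module A = Family (family base m (suc k))
    module B = Family (family base m k)
    a b : ℕ
    a = H s g m (suc k)
    b = H s g m k
    value : Fin (s * b) → Fin s
    value z = proj₁ (remQuot {s} b z)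
    base-col : Fin (s * b) → Fin b
    base-col z = proj₂ (remQuot {s} b z)
    col : Fin a ⊎ Fin (s * b) → Rows k (suc m) → ℕ
    col (inj₁ y) r = A.col y (demote r)
    col (inj₂ z) = insert (2 + toℕ (value z)) (B.col (base-col z))
    bits : ∀ u i → Bit (col u (inj₁ i))
    bits (inj₁ y) i = A.bits y (suc i)
    bits (inj₂ z) i = B.bits (base-col z) i
    small : ∀ u i → col u (inj₂ i) < 2 + s
    small (inj₁ y) zero = ≤-trans (bit<2 (A.bits y zero)) (m≤m+n 2 s)
    small (inj₁ y) (suc i) = A.small y i
    small (inj₂ z) zero = +-monoʳ-< 2 (toℕ<n (value z))
    small (inj₂ z) (suc i) = B.small (base-col z) i
    good : ∀ u → Good (col u)
    good (inj₁ y) = good-demote (A.col y) (A.good y)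
    good (inj₂ z) = good-insert (B.col (base-col z)) _ (s≤s (s≤s z≤n)) (B.good (base-col z))
    -- The two parts are told apart by the first non-binary entry (a bit versus ≥ 2).
    distinct : ∀ u u' → (∀ r → col u r ≡ col u' r) → u ≡ u'
    distinct (inj₁ y) (inj₁ y') h = cong inj₁ (A.distinct y y' λ r →
      trans (cong (A.col y) (sym (demote-promote r))) (trans (h (promote r)) (cong (A.col y') (demote-promote r))))
    distinct (inj₁ y) (inj₂ z) h = ⊥-elim (bit≢2+ _ (A.bits y zero) (h (inj₂ zero)))
    distinct (inj₂ z) (inj₁ y) h = ⊥-elim (bit≢2+ _ (A.bits y zero) (sym (h (inj₂ zero))))
    distinct (inj₂ z) (inj₂ z') h = cong inj₂ (remQuot-inj b (cong₂ _,_ same-value same-base))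
      where
      same-value : value z ≡ value z'
      same-value = toℕ-injective (+-cancelˡ-≡ 2 _ _ (h (inj₂ zero)))
      same-base : base-col z ≡ base-col z'
      same-base = B.distinct _ _ λ { (inj₁ i) → h (inj₁ i) ; (inj₂ j) → h (inj₂ (suc j)) }

NoF₁ : ∀ {k m} → (Rows k m → ℕ) → Set
NoF₁ y = ∀ a b c → ¬ b ≡ c → y a ≡ 0 → y b ≡ 1 → y c ≡ 1 → ⊥

-- Row ranks: binary rows in decreasing order above all non-binary rows, so
-- that promoting the first binary row keeps every rank.
reverse-index : ∀ k → Fin k → ℕ
reverse-index (suc k) zero = k
reverse-index (suc k) (suc i) = reverse-index k i

reverse-index< : ∀ k (i : Fin k) → reverse-index k i < k
reverse-index< (suc k) zero = n<1+n k
reverse-index< (suc k) (suc i) = <-trans (reverse-index< k i) (n<1+n k)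

rank : ∀ {k m} → Rows k m → ℕ
rank {k} (inj₁ i) = reverse-index k i
rank {k} (inj₂ j) = toℕ j + k

Ranked : ∀ {k m} → (Rows k m → ℕ) → Set
Ranked y = ∀ a b c → ¬ b ≡ c → y a ≡ 1 → y b ≡ 0 → y c ≡ 0 → rank b < rank a

rank-demote : ∀ {k m} (r : Rows k (suc m)) → rank (demote r) ≡ rank r
rank-demote (inj₁ i) = refl
rank-demote (inj₂ zero) = refl
rank-demote {k} (inj₂ (suc j)) = +-suc (toℕ j) k

rank-skip : ∀ {k m} (a b : Rows k m) → rank b < rank a → rank (skip b) < rank (skip a)
rank-skip (inj₁ i) (inj₁ i') lt = lt
rank-skip {k} (inj₁ i) (inj₂ j) lt = ⊥-elim (<-irrefl refl
  (≤-<-trans (m≤n+m k (toℕ j)) (<-trans lt (reverse-index< k i))))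
rank-skip {k} (inj₂ j) (inj₁ i) lt = ≤-trans (reverse-index< k i) (m≤n+m k (suc (toℕ j)))
rank-skip (inj₂ j) (inj₂ j') lt = s≤s lt

-- Reading rows through demote is a bijective relabelling preserving ranks.
NoF₁-demote : ∀ {k m} (y : Rows (suc k) m → ℕ) → NoF₁ y → NoF₁ (λ r → y (demote r))
NoF₁-demote y G a b c ne = G (demote a) (demote b) (demote c) (ne ∘ demote-inj)

Ranked-demote : ∀ {k m} (y : Rows (suc k) m → ℕ) → Ranked y → Ranked (λ r → y (demote r))
Ranked-demote y G a b c ne ea eb ec = subst₂ _<_ (rank-demote b) (rank-demote a)
  (G (demote a) (demote b) (demote c) (λ e → ne (demote-inj e)) ea eb ec)

bit-entry : ∀ {k m} (y : Rows k m → ℕ) v → 2 ≤ v → ∀ r w → insert v y r ≡ w → w < 2 →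
  Σ (Rows k m) λ r' → r ≡ skip r' × y r' ≡ w
bit-entry y v 2≤v (inj₁ i) w e w<2 = inj₁ i , refl , e
bit-entry y v 2≤v (inj₂ (suc j)) w e w<2 = inj₂ j , refl , e
bit-entry y v (s≤s (s≤s _)) (inj₂ zero) .(suc (suc _)) refl (s≤s (s≤s ()))

NoF₁-insert : ∀ {k m} (y : Rows k m → ℕ) v → 2 ≤ v → NoF₁ y → NoF₁ (insert v y)
NoF₁-insert y v 2≤v G a b c ne ea eb ec
  with bit-entry y v 2≤v a 0 ea (s≤s z≤n) | bit-entry y v 2≤v b 1 eb (s≤s (s≤s z≤n))
     | bit-entry y v 2≤v c 1 ec (s≤s (s≤s z≤n))
... | a' , refl , ea' | b' , refl , eb' | c' , refl , ec' = G a' b' c' (λ e → ne (cong skip e)) ea' eb' ec'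

Ranked-insert : ∀ {k m} (y : Rows k m → ℕ) v → 2 ≤ v → Ranked y → Ranked (insert v y)
Ranked-insert y v 2≤v G a b c ne ea eb ec
  with bit-entry y v 2≤v a 1 ea (s≤s (s≤s z≤n)) | bit-entry y v 2≤v b 0 eb (s≤s z≤n)
     | bit-entry y v 2≤v c 0 ec (s≤s z≤n)
... | a' , refl , ea' | b' , refl , eb' | c' , refl , ec' = rank-skip a' b' (G a' b' c' (λ e → ne (cong skip e)) ea' eb' ec')

choose : {P : Set} → Dec P → ℕ → ℕ → ℕ
choose (yes _) a b = a
choose (no _) a b = b

choose-yes : {P : Set} (d : Dec P) {a b : ℕ} → P → choose d a b ≡ a
choose-yes (yes _) p = refl
choose-yes (no np) p = ⊥-elim (np p)

choose-no : {P : Set} (d : Dec P) {a b : ℕ} → ¬ P → choose d a b ≡ b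
choose-no (yes p) np = ⊥-elim (np p)
choose-no (no _) np = refl

choose-yes⁻¹ : {P : Set} (d : Dec P) {a b : ℕ} → ¬ a ≡ b → choose d a b ≡ a → P
choose-yes⁻¹ (yes p) ne e = p
choose-yes⁻¹ (no _) ne e = ⊥-elim (ne (sym e))

choose-bit : {P : Set} (d : Dec P) {a b : ℕ} → Bit a → Bit b → Bit (choose d a b)
choose-bit (yes _) ba bb = ba
choose-bit (no _) ba bb = bb

0≢1 : ¬ 0 ≡ 1
0≢1 ()

1≢0 : ¬ 1 ≡ 0
1≢0 ()

binary-column : ∀ {k} → (Fin k → ℕ) → Rows k 0 → ℕ
binary-column f (inj₁ i) = f i

the-only : ∀ (x y : Fin 1) → x ≡ y
the-only zero zero = refl

module BinaryFamily (s : ℕ) (g : ℕ → ℕ) (Good : ∀ {k m} → (Rows k m → ℕ) → Set)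
  (good-demote : ∀ {k m} (y : Rows (suc k) m → ℕ) → Good y → Good (λ r → y (demote r)))
  (good-insert : ∀ {k m} (y : Rows k m → ℕ) v → 2 ≤ v → Good y → Good (insert v y)) where
  open Families s g Good good-demote good-insert public

  binary-family : ∀ k N (col : Fin N → Fin k → ℕ) → (∀ x y → (∀ i → col x i ≡ col y i) → x ≡ y) →
    (∀ x i → Bit (col x i)) → (∀ x → Good (binary-column (col x))) → Family k 0 N
  binary-family k N col d b gd = record
    { col = λ x → binary-column (col x) ; distinct = λ x y h → d x y (λ i → h (inj₁ i))
    ; bits = b ; small = λ x () ; good = gd }

  empty-family : (∀ y → Good {0} {0} y) → Family 0 0 1
  empty-family gd = binary-family 0 1 (λ _ ()) (λ x y _ → the-only x y) (λ x ()) (λ x → gd _)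

  one-row-family : (∀ (x : Fin 2) → Good (binary-column (λ _ → toℕ x))) → Family 1 0 2
  one-row-family gd = binary-family 1 2 (λ x _ → toℕ x) (λ x y h → toℕ-injective (h zero)) bits gd
    where
    bits : ∀ (x : Fin 2) i → Bit (toℕ x)
    bits zero i = inj₁ refl
    bits (suc zero) i = inj₂ refl

-- The zero column, the all-ones column and the k unit vectors: these avoid F₁,
-- which only asks for a 0 and two 1s within one column.
module NoF₁-base (s : ℕ) where
  open BinaryFamily s g₂ NoF₁ NoF₁-demote NoF₁-insert

  unit : ∀ {k} → Fin k → Fin k → ℕ
  unit i r = choose (r ≟ i) 1 0

  unit-i : ∀ {k} (i : Fin k) → unit i i ≡ 1
  unit-i i = choose-yes (i ≟ i) refl

  columns : ∀ k → Fin (4 + k) → Fin (2 + k) → ℕ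
  columns k zero r = 0
  columns k (suc zero) r = 1
  columns k (suc (suc i)) = unit i

  another : ∀ {k} → Fin (2 + k) → Fin (2 + k)
  another zero = suc zero
  another (suc _) = zero

  another≢ : ∀ {k} (i : Fin (2 + k)) → ¬ another i ≡ i
  another≢ zero ()
  another≢ (suc i) ()

  unit-another : ∀ {k} (i : Fin (2 + k)) → unit i (another i) ≡ 0
  unit-another i = choose-no (another i ≟ i) (another≢ i)

  distinct : ∀ k x y → (∀ i → columns k x i ≡ columns k y i) → x ≡ y
  distinct k zero zero h = refl
  distinct k (suc zero) (suc zero) h = refl
  distinct k zero (suc zero) h = ⊥-elim (0≢1 (h zero))
  distinct k (suc zero) zero h = ⊥-elim (1≢0 (h zero))
  distinct k zero (suc (suc j)) h = ⊥-elim (0≢1 (trans (h j) (unit-i j)))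
  distinct k (suc (suc j)) zero h = ⊥-elim (1≢0 (trans (sym (unit-i j)) (h j)))
  distinct k (suc zero) (suc (suc j)) h = ⊥-elim (1≢0 (trans (h (another j)) (unit-another j)))
  distinct k (suc (suc j)) (suc zero) h = ⊥-elim (0≢1 (trans (sym (unit-another j)) (h (another j))))
  distinct k (suc (suc i)) (suc (suc j)) h =
    cong (λ x → suc (suc x)) (choose-yes⁻¹ (i ≟ j) 1≢0 (trans (sym (h i)) (unit-i i)))

  bits : ∀ k x i → Bit (columns k x i)
  bits k zero i = inj₁ refl
  bits k (suc zero) i = inj₂ refl
  bits k (suc (suc j)) i = choose-bit (i ≟ j) (inj₂ refl) (inj₁ refl)

  no-F₁ : ∀ k x → NoF₁ (binary-column (columns k x))
  no-F₁ k zero a (inj₁ b) c ne ea () ec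
  no-F₁ k (suc zero) (inj₁ a) b c ne () eb ec
  no-F₁ k (suc (suc j)) a (inj₁ b) (inj₁ c) ne ea eb ec =
    ne (cong inj₁ (trans (choose-yes⁻¹ (b ≟ j) 1≢0 eb) (sym (choose-yes⁻¹ (c ≟ j) 1≢0 ec))))

  base : ∀ k → Family k 0 (g₂ k)
  base zero = empty-family λ y → λ { (inj₁ ()) }
  base (suc zero) = one-row-family λ { x a (inj₁ zero) (inj₁ zero) ne → ⊥-elim (ne refl) }
  base (suc (suc k)) = binary-family (2 + k) (4 + k) (columns k) (distinct k) (bits k) (no-F₁ k)

-- Ranked columns on k + 1 binary rows: from the 2k columns on the k lower rows
-- with a 1 prepended, plus (0,1,…,1) and (0,…,0).  Prepending a 1 keeps a
-- column ranked because row 0 has the highest rank.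
module Ranked-base (s : ℕ) where
  open BinaryFamily s g₄ Ranked Ranked-demote Ranked-insert

  prepend : ∀ {k} → ℕ → (Rows k 0 → ℕ) → Rows (suc k) 0 → ℕ
  prepend v y (inj₁ zero) = v
  prepend v y (inj₁ (suc i)) = y (inj₁ i)

  ranked-prepend : ∀ {k} (y : Rows k 0 → ℕ) → Ranked y → Ranked (prepend 1 y)
  ranked-prepend y G (inj₁ zero) (inj₁ (suc b)) c ne ea eb ec = reverse-index< _ b
  ranked-prepend y G (inj₁ (suc a)) (inj₁ (suc b)) (inj₁ (suc c)) ne ea eb ec =
    G (inj₁ a) (inj₁ b) (inj₁ c) (λ { refl → ne refl }) ea eb ec

  head-zero : ∀ {k} → Rows (suc k) 0 → ℕ
  head-zero (inj₁ zero) = 0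
  head-zero (inj₁ (suc i)) = 1

  extend : ∀ {k N} → Family (suc k) 0 N → Family (suc (suc k)) 0 (2 + N)
  extend {k} {N} F = record { col = col ; distinct = distinct ; bits = bits ; small = λ x () ; good = good }
    where
    module F = Family F
    col : Fin (2 + N) → Rows (suc (suc k)) 0 → ℕ
    col zero = head-zero
    col (suc zero) = λ _ → 0
    col (suc (suc x)) = prepend 1 (F.col x)
    distinct : ∀ x y → (∀ r → col x r ≡ col y r) → x ≡ y
    distinct zero zero h = refl
    distinct (suc zero) (suc zero) h = refl
    distinct zero (suc zero) h = ⊥-elim (1≢0 (h (inj₁ (suc zero))))
    distinct (suc zero) zero h = ⊥-elim (0≢1 (h (inj₁ (suc zero))))
    distinct zero (suc (suc y)) h = ⊥-elim (0≢1 (h (inj₁ zero)))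
    distinct (suc (suc x)) zero h = ⊥-elim (1≢0 (h (inj₁ zero)))
    distinct (suc zero) (suc (suc y)) h = ⊥-elim (0≢1 (h (inj₁ zero)))
    distinct (suc (suc x)) (suc zero) h = ⊥-elim (1≢0 (h (inj₁ zero)))
    distinct (suc (suc x)) (suc (suc y)) h =
      cong (λ z → suc (suc z)) (F.distinct x y λ { (inj₁ i) → h (inj₁ (suc i)) })
    bits : ∀ x i → Bit (col x (inj₁ i))
    bits zero zero = inj₁ refl
    bits zero (suc i) = inj₂ refl
    bits (suc zero) i = inj₁ refl
    bits (suc (suc x)) zero = inj₂ refl
    bits (suc (suc x)) (suc i) = F.bits x i
    good : ∀ x → Ranked (col x)
    good zero a (inj₁ zero) (inj₁ zero) ne = ⊥-elim (ne refl)
    good zero (inj₁ zero) b c ne ()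
    good (suc zero) (inj₁ _) b c ne ()
    good (suc (suc x)) = ranked-prepend (F.col x) (F.good x)

  base : ∀ k → Family k 0 (g₄ k)
  base zero = empty-family λ y → λ { (inj₁ ()) }
  base (suc zero) = one-row-family λ { x a (inj₁ zero) (inj₁ zero) ne → ⊥-elim (ne refl) }
  base (suc (suc k)) = subst (Family (suc (suc k)) 0) (sym (*-suc 2 (suc k))) (extend (base (suc k)))

-- F₁ is the second column of F₂ with its rows in the order 3, 1, 2.
F₁-in-F₂ : ∀ {R : Set} {n} (M : Mat R n) → Occurs M F₂ → Occurs M F₁
F₁-in-F₂ M (ρ , γ , ρi , γi , e) = ρ ∘ π , (λ _ → γ 1F) , ∘-inj ρi π-inj , (λ { {0F} {0F} _ → refl }) ,
    λ { 0F 0F → e 2F 1F ; 1F 0F → e 0F 1F ; 2F 0F → e 1F 1F }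
  where
  π : Fin 3 → Fin 3
  π 0F = 2F
  π 1F = 0F
  π 2F = 1F
  π-inj : Inj π
  π-inj {0F} {0F} _ = refl
  π-inj {1F} {1F} _ = refl
  π-inj {2F} {2F} _ = refl
  π-inj {0F} {1F} ()
  π-inj {0F} {2F} ()
  π-inj {1F} {0F} ()
  π-inj {1F} {2F} ()
  π-inj {2F} {0F} ()
  π-inj {2F} {1F} ()

-- F₃ is formed by the first two columns of F₄.
F₃-in-F₄ : ∀ {R : Set} {n} (M : Mat R n) → Occurs M F₄ → Occurs M F₃
F₃-in-F₄ M (ρ , γ , ρi , γi , e) = ρ , γ ∘ ι , ρi , ∘-inj γi ι-inj ,
    λ { 0F 0F → e 0F 0F ; 1F 0F → e 1F 0F ; 2F 0F → e 2F 0F ; 0F 1F → e 0F 1F ; 1F 1F → e 1F 1F ; 2F 1F → e 2F 1F }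
  where
  ι : Fin 2 → Fin 4
  ι 0F = 0F
  ι 1F = 1F
  ι-inj : Inj ι
  ι-inj {0F} {0F} _ = refl
  ι-inj {1F} {1F} _ = refl
  ι-inj {0F} {1F} ()
  ι-inj {1F} {0F} ()

module Realise {s m N} (col : Fin N → Rows 0 m → ℕ)
  (distinct : ∀ x y → (∀ r → col x r ≡ col y r) → x ≡ y)
  (small : ∀ x i → col x (inj₂ i) < 2 + s) where

  A : RMatrix (2 + s) m N
  A i j = fromℕ< (small j i)

  simple : Simple A
  simple j j' h = distinct j j' λ { (inj₂ i) →
    trans (sym (toℕ-fromℕ< (small j i))) (trans (cong toℕ (h i)) (toℕ-fromℕ< (small j' i))) }

  module _ {k l} {F : Config k l} (c : Contains A F) where
    row : Fin k → Rows 0 m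
    row = inj₂ ∘ proj₁ c
    column : Fin l → Fin N
    column = proj₁ (proj₂ c)

    entry : ∀ i j → col (column j) (row i) ≡ F i j
    entry i j = trans (sym (toℕ-fromℕ< (small _ _))) (proj₂ (proj₂ (proj₂ (proj₂ c))) i j)

    rows-differ : ∀ {i i'} → ¬ i ≡ i' → ¬ row i ≡ row i'
    rows-differ ne e = ne (proj₁ (proj₂ (proj₂ c)) (inj₂-injective e))

  -- The F₁ pattern is a single column.
  avoids-F₁ : (∀ x → NoF₁ (col x)) → Avoids A F₁
  avoids-F₁ good c = good _ _ _ _ (rows-differ c {1F} {2F} λ ()) (entry c 0F 0F) (entry c 1F 0F) (entry c 2F 0F)

  -- The columns (1,0,0) and (0,1,0) of F₃ would force the first two rows to outrank each other.
  avoids-F₃ : (∀ x → Ranked (col x)) → Avoids A F₃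
  avoids-F₃ good c = <-asym
    (good _ _ _ _ (rows-differ c {1F} {2F} λ ()) (entry c 0F 0F) (entry c 1F 0F) (entry c 2F 0F))
    (good _ _ _ _ (rows-differ c {0F} {2F} λ ()) (entry c 1F 1F) (entry c 0F 1F) (entry c 2F 1F))

sandwich : ∀ {m r N k l k' l'} {F : Config k l} {G : Config k' l'} →
  (∀ {n} (A : RMatrix r m n) → Contains A G → Contains A F) →
  (Σ (RMatrix r m N) λ A → Simple A × Avoids A F) →
  (∀ n (A : RMatrix r m n) → Simple A → Avoids A G → n ≤ N) →
  IsForb m r F N × IsForb m r G N
sandwich F-in-G (A , sA , avA) bound =
  ((A , sA , avA) , λ n A' sA' av → bound n A' sA' (av ∘ F-in-G A')) ,
  ((A , sA , avA ∘ F-in-G A) , bound)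

-- m · b^(m-1), the derivative of b^m, and its recurrence.
deriv : ℕ → ℕ → ℕ
deriv b m = m * b ^ (m ∸ 1)

deriv-step : ∀ b m → deriv b (suc m) ≡ b ^ m + b * deriv b m
deriv-step b zero = identity b
  where
  identity : ∀ b → 1 * 1 ≡ 1 + b * 0
  identity = solve-∀
deriv-step b (suc m) = identity b (b ^ m) m
  where
  identity : ∀ b P m → suc (suc m) * (b * P) ≡ b * P + b * (suc m * P)
  identity = solve-∀

H-linear : ∀ s g α β k₀ → (∀ k → g (k₀ + k) ≡ α * (k₀ + k) + β) →
  ∀ m k → H s g m (k₀ + k) ≡ (α * (k₀ + k) + β) * suc s ^ m + α * deriv (suc s) m
H-linear s g α β k₀ hg zero k = trans (hg k) (identity (α * (k₀ + k) + β) α)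
  where
  identity : ∀ x α → x ≡ x * 1 + α * 0
  identity = solve-∀
H-linear s g α β k₀ hg (suc m) k = begin
  H s g m (suc (k₀ + k)) + s * H s g m (k₀ + k)
    ≡⟨ cong₂ (λ x y → x + s * y)
         (trans (cong (H s g m) (sym (+-suc k₀ k))) (H-linear s g α β k₀ hg m (suc k)))
         (H-linear s g α β k₀ hg m k) ⟩
  (α * (k₀ + suc k) + β) * P + α * D + s * ((α * (k₀ + k) + β) * P + α * D)
    ≡⟨ identity α β k₀ k s P D ⟩
  (α * (k₀ + k) + β) * (suc s * P) + α * (P + suc s * D)
    ≡⟨ cong (λ z → (α * (k₀ + k) + β) * (suc s * P) + α * z) (sym (deriv-step (suc s) m)) ⟩
  (α * (k₀ + k) + β) * suc s ^ suc m + α * deriv (suc s) (suc m) ∎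
  where
  P D : ℕ
  P = suc s ^ m
  D = deriv (suc s) m
  identity : ∀ α β k₀ k s P D →
    (α * (k₀ + suc k) + β) * P + α * D + s * ((α * (k₀ + k) + β) * P + α * D)
    ≡ (α * (k₀ + k) + β) * (suc s * P) + α * (P + suc s * D)
  identity = solve-∀

-- For F₄: g₄(k) = 2k when k ≥ 1, and the exceptional value g₄(0) = 1
-- contributes s^m.
H₄-at-0 : ∀ s m → H s g₄ m 0 ≡ 2 * deriv (suc s) m + s ^ m
H₄-at-0 s zero = refl
H₄-at-0 s (suc m) = begin
  H s g₄ m 1 + s * H s g₄ m 0
    ≡⟨ cong₂ (λ x y → x + s * y)
         (H-linear s g₄ 2 0 1 (λ k → sym (+-identityʳ (2 * suc k))) m 0) (H₄-at-0 s m) ⟩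
  (2 * 1 + 0) * P + 2 * D + s * (2 * D + s ^ m)
    ≡⟨ identity s P D (s ^ m) ⟩
  2 * (P + suc s * D) + s * s ^ m
    ≡⟨ cong (λ z → 2 * z + s * s ^ m) (sym (deriv-step (suc s) m)) ⟩
  2 * deriv (suc s) (suc m) + s ^ suc m ∎
  where
  P D : ℕ
  P = suc s ^ m
  D = deriv (suc s) m
  identity : ∀ s P D S → (2 * 1 + 0) * P + 2 * D + s * (2 * D + S) ≡ 2 * (P + suc s * D) + s * S
  identity = solve-∀

g₂-linear : ∀ k → g₂ (2 + k) ≡ 1 * (2 + k) + 2
g₂-linear = identity
  where
  identity : ∀ k → 4 + k ≡ 1 * (2 + k) + 2
  identity = solve-∀

H₂-at-1 : ∀ s m → H s g₂ m 1 + s ^ m ≡ 3 * suc s ^ m + deriv (suc s) m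
H₂-at-1 s zero = refl
H₂-at-1 s (suc m) = begin
  H s g₂ m 2 + s * H s g₂ m 1 + s * s ^ m
    ≡⟨ cong (λ x → x + s * H s g₂ m 1 + s * s ^ m) (H-linear s g₂ 1 2 2 g₂-linear m 0) ⟩
  (1 * 2 + 2) * P + 1 * D + s * H s g₂ m 1 + s * s ^ m
    ≡⟨ regroup s P D (H s g₂ m 1) (s ^ m) ⟩
  4 * P + D + s * (H s g₂ m 1 + s ^ m)
    ≡⟨ cong (λ z → 4 * P + D + s * z) (H₂-at-1 s m) ⟩
  4 * P + D + s * (3 * P + D)
    ≡⟨ identity s P D ⟩
  3 * (suc s * P) + (P + suc s * D)
    ≡⟨ cong (λ z → 3 * (suc s * P) + z) (sym (deriv-step (suc s) m)) ⟩
  3 * suc s ^ suc m + deriv (suc s) (suc m) ∎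
  where
  P D : ℕ
  P = suc s ^ m
  D = deriv (suc s) m
  regroup : ∀ s P D X S → (1 * 2 + 2) * P + 1 * D + s * X + s * S ≡ 4 * P + D + s * (X + S)
  regroup = solve-∀
  identity : ∀ s P D → 4 * P + D + s * (3 * P + D) ≡ 3 * (suc s * P) + (P + suc s * D)
  identity = solve-∀

H₂-at-0 : ∀ s m → H s g₂ m 0 + s ^ m + deriv s m ≡ 2 * suc s ^ m + deriv (suc s) m
H₂-at-0 s zero = refl
H₂-at-0 s (suc m) = begin
  H s g₂ m 1 + s * H s g₂ m 0 + s * s ^ m + deriv s (suc m)
    ≡⟨ cong (λ z → H s g₂ m 1 + s * H s g₂ m 0 + s * s ^ m + z) (deriv-step s m) ⟩
  H s g₂ m 1 + s * H s g₂ m 0 + s * s ^ m + (s ^ m + s * deriv s m)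
    ≡⟨ regroup s (H s g₂ m 1) (H s g₂ m 0) (s ^ m) (deriv s m) ⟩
  (H s g₂ m 1 + s ^ m) + s * (H s g₂ m 0 + s ^ m + deriv s m)
    ≡⟨ cong₂ (λ x y → x + s * y) (H₂-at-1 s m) (H₂-at-0 s m) ⟩
  3 * P + D + s * (2 * P + D)
    ≡⟨ identity s P D ⟩
  2 * (suc s * P) + (P + suc s * D)
    ≡⟨ cong (λ z → 2 * (suc s * P) + z) (sym (deriv-step (suc s) m)) ⟩
  2 * suc s ^ suc m + deriv (suc s) (suc m) ∎
  where
  P D : ℕ
  P = suc s ^ m
  D = deriv (suc s) m
  regroup : ∀ s X Y S E → X + s * Y + s * S + (S + s * E) ≡ (X + S) + s * (Y + S + E)
  regroup = solve-∀
  identity : ∀ s P D → 3 * P + D + s * (2 * P + D) ≡ 2 * (suc s * P) + (P + suc s * D)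
  identity = solve-∀

difference : ∀ a d b c h → h + b + c ≡ d + a → + a ℤ.+ + d ℤ.- + b ℤ.- + c ≡ + h
difference a d b c h e = begin
  + a ℤ.+ + d ℤ.- + b ℤ.- + c
    ≡⟨ cong (λ z → z ℤ.- + b ℤ.- + c) (trans (sym (pos-+ a d)) (cong +_ (trans (+-comm a d) (sym e)))) ⟩
  + (h + b + c) ℤ.- + b ℤ.- + c
    ≡⟨ cong (λ z → z ℤ.- + b ℤ.- + c) (trans (pos-+ (h + b) c) (cong (ℤ._+ + c) (pos-+ h b))) ⟩
  + h ℤ.+ + b ℤ.+ + c ℤ.- + b ℤ.- + c
    ≡⟨ cancel (+ h) (+ b) (+ c) ⟩
  + h ∎
  where
  cancel : ∀ (x y z : ℤ) → x ℤ.+ y ℤ.+ z ℤ.- y ℤ.- z ≡ x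
  cancel = ℤ-Ring.solve-∀

boundA≡H : ∀ s m → boundA m (2 + s) ≡ + H s g₂ m 0
boundA≡H s m = difference (deriv (suc s) m) (2 * suc s ^ m) (s ^ m) (deriv s m) (H s g₂ m 0) (H₂-at-0 s m)

boundB≡H : ∀ s m → boundB m (2 + s) ≡ + H s g₄ m 0
boundB≡H s m = cong +_ (begin
  2 * m * suc s ^ (m ∸ 1) + s ^ m ≡⟨ cong (_+ s ^ m) (*-assoc 2 m (suc s ^ (m ∸ 1))) ⟩
  2 * deriv (suc s) m + s ^ m     ≡⟨ sym (H₄-at-0 s m) ⟩
  H s g₄ m 0 ∎)

forb-eqs : ∀ {m r N k l k' l'} {F : Config k l} {G : Config k' l'} {v : ℤ} →
  v ≡ + N → IsForb m r F N × IsForb m r G N → ForbEq m r F v × ForbEq m r G v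
forb-eqs e (isF , isG) = (_ , isF , sym e) , (_ , isG , sym e)

F₁-free-matrix : ∀ s m → Σ (RMatrix (2 + s) m (H s g₂ m 0)) λ A → Simple A × Avoids A F₁
F₁-free-matrix s m = A , simple , avoids-F₁ good
  where
  open Families s g₂ NoF₁ NoF₁-demote NoF₁-insert
  open Family (family (NoF₁-base.base s) m 0)
  open Realise col distinct small

F₃-free-matrix : ∀ s m → Σ (RMatrix (2 + s) m (H s g₄ m 0)) λ A → Simple A × Avoids A F₃
F₃-free-matrix s m = A , simple , avoids-F₃ good
  where
  open Families s g₄ Ranked Ranked-demote Ranked-insert
  open Family (family (Ranked-base.base s) m 0)
  open Realise col distinct small

corollary7p1 : (r m : ℕ) → 2 ≤ r → 3 ≤ m →
    ForbEq m r F₁ (boundA m r) × ForbEq m r F₂ (boundA m r) ×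
    ForbEq m r F₃ (boundB m r) × ForbEq m r F₄ (boundB m r)
corollary7p1 (suc (suc s)) m (s≤s (s≤s _)) _
  with forb-eqs (boundA≡H s m) (sandwich (F₁-in-F₂ ∘ entries) (F₁-free-matrix s m)
         λ _ → Upper.r-matrix-bound s g₂ F₂ F₂-binary-bound m)
     | forb-eqs (boundB≡H s m) (sandwich (F₃-in-F₄ ∘ entries) (F₃-free-matrix s m)
         λ _ → Upper.r-matrix-bound s g₄ F₄ F₄-binary-bound m)
... | forb-F₁ , forb-F₂ | forb-F₃ , forb-F₄ = forb-F₁ , forb-F₂ , forb-F₃ , forb-F₄
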